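{- Let $G$ be an induced-minor-minimal non-$2$-cograph with $|V(G)| \geq 6$, and let $abcd$ be a path in $G$ such that both $b$ and $c$ have degree two in $G$. Then $a$ and $d$ are adjacent in $G$.
   Context: All graphs are finite and simple; $\overline{G}$ denotes the complement of $G$. A graph is $2$-connected if it has at least three vertices, is connected, and has no cut vertex. A graph $G$ is a $2$-cograph if $G$ has no induced subgraph $H$ such that both $H$ and $\overline{H}$ are $2$-connected. For an edge $e$, $G/e$ is the simple graph obtained by contracting $e$ and removing parallel edges. An induced minor of $G$ is a graph obtained from $G$ by a sequence of vertex deletions and edge contractions; it is proper if at least one such operation is performed. An induced-minor-minimal non-$2$-cograph is a graph that is not a $2$-cograph but all of whose proper induced minors are $2$-cographs. -}

module Defs where

open import Data.Nat using (ℕ; zero; suc; _≤_)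
open import Data.Fin using (Fin; punchIn; _≟_)
open import Data.Fin.Properties using ()
open import Data.Bool using (Bool; true; false; _∧_; _∨_; not)
open import Data.Bool.Properties using (∨-comm; ∧-zeroʳ)
open import Data.List using (List; length; filterᵇ; allFin)
open import Data.Product using (Σ; _×_; _,_)
open import Data.Empty using (⊥; ⊥-elim)
open import Relation.Nullary using (¬_; yes; no; does)
open import Relation.Binary.PropositionalEquality using (_≡_; refl; sym; cong₂)
open import Function.Definitions using (Injective)

record Graph (n : ℕ) : Set where
  field
    adj    : Fin n → Fin n → Bool
    symm   : ∀ i j → adj i j ≡ adj j i
    irrefl : ∀ i → adj i i ≡ false
open Graph public

_==_ : ∀ {n} → Fin n → Fin n → Bool
i == j = does (i ≟ j)

==-sym : ∀ {n} (i j : Fin n) → (i == j) ≡ (j == i)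
==-sym i j with i ≟ j | j ≟ i
... | yes _ | yes _ = refl
... | no  _ | no  _ = refl
... | yes p | no q = ⊥-elim (q (sym p))
... | no p | yes q = ⊥-elim (p (sym q))

==-refl : ∀ {n} (i : Fin n) → (i == i) ≡ true
==-refl i with i ≟ i
... | yes _ = refl
... | no p = ⊥-elim (p refl)

fromRel : ∀ {n} → (Fin n → Fin n → Bool) → Graph n
fromRel r = record
  { adj    = λ i j → (r i j ∨ r j i) ∧ not (i == j)
  ; symm   = λ i j → cong₂ (λ x y → x ∧ not y) (∨-comm (r i j) (r j i)) (==-sym i j)
  ; irrefl = λ i → helper i
  }
  where
  helper : ∀ i → ((r i i ∨ r i i) ∧ not (i == i)) ≡ false
  helper i with i ≟ i
  ... | yes _ = ∧-zeroʳ (r i i ∨ r i i)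
  ... | no p = ⊥-elim (p refl)

complement : ∀ {n} → Graph n → Graph n
complement G = fromRel (λ i j → not (adj G i j))

induced : ∀ {m n} → Graph n → (Fin m → Fin n) → Graph m
induced G f = fromRel (λ i j → adj G (f i) (f j))

deleteV : ∀ {n} → Graph (suc n) → Fin (suc n) → Graph n
deleteV G v = induced G (punchIn v)

-- G / uv : contract edge uv, keeping u and deleting v; u becomes adjacent to
-- all former neighbours of v (parallel edges/loops are discarded).
contract : ∀ {n} → Graph (suc n) → Fin (suc n) → Fin (suc n) → Graph n
contract G u v = fromRel (λ x y →
  adj G (punchIn v x) (punchIn v y) ∨ ((punchIn v x == u) ∧ adj G v (punchIn v y)))

data Walk {n} (G : Graph n) : Fin n → Fin n → Set where
  nil  : ∀ {i} → Walk G i i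
  cons : ∀ {i j k} → adj G i j ≡ true → Walk G j k → Walk G i k

Connected : ∀ {n} → Graph n → Set
Connected G = ∀ i j → Walk G i j

-- 2-connected: at least three vertices, connected, and no cut vertex
-- (for connected G, v is a cut vertex iff G - v is disconnected).
TwoConnected : ∀ {n} → Graph n → Set
TwoConnected {zero} G = ⊥
TwoConnected {suc n} G = (3 ≤ suc n) × Connected G × (∀ v → Connected (deleteV G v))

TwoCograph : ∀ {n} → Graph n → Set
TwoCograph {n} G = ∀ (m : ℕ) (f : Fin m → Fin n) → Injective _≡_ _≡_ f →
  ¬ (TwoConnected (induced G f) × TwoConnected (complement (induced G f)))

data InducedMinor {m} (H : Graph m) : ∀ {n} → Graph n → Set where
  same : InducedMinor H H
  del  : ∀ {n} {G : Graph (suc n)} (v : Fin (suc n)) →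
         InducedMinor H (deleteV G v) → InducedMinor H G
  con  : ∀ {n} {G : Graph (suc n)} (u v : Fin (suc n)) → adj G u v ≡ true →
         InducedMinor H (contract G u v) → InducedMinor H G

data ProperInducedMinor {m} (H : Graph m) : ∀ {n} → Graph n → Set where
  del  : ∀ {n} {G : Graph (suc n)} (v : Fin (suc n)) →
         InducedMinor H (deleteV G v) → ProperInducedMinor H G
  con  : ∀ {n} {G : Graph (suc n)} (u v : Fin (suc n)) → adj G u v ≡ true →
         InducedMinor H (contract G u v) → ProperInducedMinor H G

MinimalNon2Cograph : ∀ {n} → Graph n → Set
MinimalNon2Cograph G = ¬ TwoCograph G ×
  (∀ {m} (H : Graph m) → ProperInducedMinor H G → TwoCograph H)

degree : ∀ {n} → Graph n → Fin n → ℕ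
degree {n} G v = length (filterᵇ (adj G v) (allFin n))

-- Suppose a ≁ d. If a and d have a common neighbour s, then a b c d s is an
-- induced 5-cycle, because b and c have no further neighbours. C5 and its
-- complement are 2-connected, and G has a sixth vertex v, so G − v is not a
-- 2-cograph, contradicting minimality.
--
-- Otherwise contract bc. By minimality an induced subgraph that is 2-connected
-- with 2-connected complement must span G, so G is 2-connected, and therefore
-- so is G/bc. In the complement of G/bc the merged vertex is adjacent to all
-- vertices but a and d, a is adjacent to d, and every other vertex is adjacent
-- to a or to d, as they have no common neighbour in G. Neighbours t of a and s
-- of d off the path then route around any deleted vertex, so the complement is
-- 2-connected too, and G/bc is a proper induced minor that is not a 2-cograph.

module Submission where

open import Defs
open import Data.Nat using (ℕ; zero; suc; _≤_; _<_; z≤n; s≤s)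
open import Data.Nat.Properties using (≤-trans; ≤-pred; <⇒≱)
open import Data.Fin using (Fin; zero; suc; punchIn; punchOut; _≟_)
open import Data.Fin.Properties
  using (punchIn-injective; punchInᵢ≢i; punchIn-punchOut; punchOut-injective;
         all?; any?; ¬∀⟶∃¬; injective⇒≤)
open import Data.Bool using (Bool; true; false; _∧_; _∨_; not; T; T?)
import Data.Bool as Bool
open import Data.Bool.Properties using (∨-idem; ∨-zeroʳ; ∨-identityʳ; ∧-identityʳ; ¬-not; T-≡)
open import Data.List using (List; []; _∷_; length; filterᵇ; allFin)
open import Data.Vec using (lookup; _∷_; [])
open import Data.List.Membership.Propositional using (_∈_)
open import Data.List.Membership.Propositional.Properties using (∈-filter⁺; ∈-allFin)
open import Data.List.Relation.Unary.Any using (here; there)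
open import Data.Maybe using (Maybe; just; nothing; maybe′; is-just; to-witness-T)
open import Data.Product using (∃; _×_; _,_; proj₁; proj₂)
open import Data.Sum using (_⊎_; inj₁; inj₂) renaming (map to ⊎-map)
open import Data.Unit using (⊤; tt)
open import Data.Empty using (⊥; ⊥-elim)
open import Function using (_∘_; id)
open import Function.Bundles using (Equivalence)
open import Function.Definitions using (Injective)
open import Relation.Nullary using (¬_; Dec; yes; no; ¬?)
open import Relation.Nullary.Decidable using (from-yes; decidable-stable; _⊎-dec_; _×-dec_)
open import Relation.Binary.PropositionalEquality
  using (_≡_; _≢_; refl; sym; trans; cong; cong₂; subst; subst₂; ≢-sym; module ≡-Reasoning)

private
  variable
    m n : ℕ

==-≢ : {i j : Fin n} → i ≢ j → (i == j) ≡ false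
==-≢ {i = i} {j} i≢j with i ≟ j
... | yes i≡j = ⊥-elim (i≢j i≡j)
... | no _ = refl

==-≡ : {i j : Fin n} → i ≡ j → (i == j) ≡ true
==-≡ {i = i} refl = ==-refl i

adj⇒≢ : (G : Graph n) {i j : Fin n} → adj G i j ≡ true → i ≢ j
adj⇒≢ G {i} i~j refl with trans (sym i~j) (irrefl G i)
... | ()

adj-flip : (G : Graph n) {i j : Fin n} → adj G i j ≡ true → adj G j i ≡ true
adj-flip G {i} {j} i~j = trans (symm G j i) i~j

distinct-by-adj : (G : Graph n) {x y y′ : Fin n} → adj G x y ≡ true → adj G x y′ ≡ false → y ≢ y′
distinct-by-adj G x~y x≁y′ refl with trans (sym x~y) x≁y′
... | ()

fromRel-adj : (r : Fin n → Fin n → Bool) {i j : Fin n} → i ≢ j →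
              adj (fromRel r) i j ≡ r i j ∨ r j i
fromRel-adj r {i} {j} i≢j rewrite ==-≢ i≢j = ∧-identityʳ (r i j ∨ r j i)

fromRel-adj-intro : (r : Fin n → Fin n → Bool) {i j : Fin n} → i ≢ j → r i j ≡ true →
  adj (fromRel r) i j ≡ true
fromRel-adj-intro r {i} {j} i≢j rij rewrite ==-≢ i≢j | rij = refl

fromRel-adj-symmetric : (r : Fin n → Fin n → Bool) → (∀ i j → r i j ≡ r j i) →
                        {i j : Fin n} → i ≢ j → adj (fromRel r) i j ≡ r i j
fromRel-adj-symmetric r r-sym {i} {j} i≢j = begin
  adj (fromRel r) i j ≡⟨ fromRel-adj r i≢j ⟩
  r i j ∨ r j i       ≡⟨ cong (r i j ∨_) (r-sym j i) ⟩
  r i j ∨ r i j       ≡⟨ ∨-idem (r i j) ⟩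
  r i j               ∎
  where open ≡-Reasoning

induced-adj : (G : Graph n) (f : Fin m → Fin n) (i j : Fin m) →
              adj (induced G f) i j ≡ adj G (f i) (f j)
induced-adj G f i j = by-cases (i ≟ j)
  where
  by-cases : Dec (i ≡ j) → adj (induced G f) i j ≡ adj G (f i) (f j)
  by-cases (yes refl) = trans (irrefl (induced G f) i) (sym (irrefl G (f i)))
  by-cases (no i≢j) = fromRel-adj-symmetric _ (λ k l → symm G (f k) (f l)) i≢j

deleteV-adj : (G : Graph (suc n)) (v : Fin (suc n)) (i j : Fin n) →
              adj (deleteV G v) i j ≡ adj G (punchIn v i) (punchIn v j)
deleteV-adj G v = induced-adj G (punchIn v)

complement-adj : (H : Graph n) {i j : Fin n} → i ≢ j → adj H i j ≡ false →
                 adj (complement H) i j ≡ true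
complement-adj H {i} {j} i≢j i≁j =
  trans (fromRel-adj-symmetric _ (λ k l → cong not (symm H k l)) i≢j) (cong not i≁j)

_≈ᴳ_ : Graph n → Graph n → Set
H ≈ᴳ H′ = ∀ i j → adj H i j ≡ adj H′ i j

complement-cong : {H H′ : Graph n} → H ≈ᴳ H′ → complement H ≈ᴳ complement H′
complement-cong H≈H′ i j rewrite H≈H′ i j | H≈H′ j i = refl

-- Walks inside a vertex set, and cut vertices

data WalkIn (G : Graph n) (P : Fin n → Set) : Fin n → Fin n → Set where
  stop : ∀ {i} → P i → WalkIn G P i i
  step : ∀ {i j k} → P i → adj G i j ≡ true → WalkIn G P j k → WalkIn G P i k

module _ {G : Graph n} {P : Fin n → Set} where

  walkIn-head : ∀ {i j} → WalkIn G P i j → P i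
  walkIn-head (stop p) = p
  walkIn-head (step p _ _) = p

  walkIn-++ : ∀ {i j k} → WalkIn G P i j → WalkIn G P j k → WalkIn G P i k
  walkIn-++ (stop _) w = w
  walkIn-++ (step p e w) w′ = step p e (walkIn-++ w w′)

  walkIn-reverse : ∀ {i j} → WalkIn G P i j → WalkIn G P j i
  walkIn-reverse (stop p) = stop p
  walkIn-reverse (step p e w) =
    walkIn-++ (walkIn-reverse w) (step (walkIn-head w) (adj-flip G e) (stop p))

  walkIn⇒walk : ∀ {i j} → WalkIn G P i j → Walk G i j
  walkIn⇒walk (stop _) = nil
  walkIn⇒walk (step _ e w) = cons e (walkIn⇒walk w)

  walkIn-firstStep : ∀ {i j} → i ≢ j → WalkIn G P i j → ∃ λ k → adj G i k ≡ true × P k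
  walkIn-firstStep i≢i (stop _) = ⊥-elim (i≢i refl)
  walkIn-firstStep _ (step _ e w) = _ , e , walkIn-head w

walk⇒walkIn : {G : Graph n} {i j : Fin n} → Walk G i j → WalkIn G (λ _ → ⊤) i j
walk⇒walkIn nil = stop tt
walk⇒walkIn (cons e w) = step tt e (walk⇒walkIn w)

walkIn-map : {G : Graph m} {H : Graph n} {P : Fin m → Set} {Q : Fin n → Set}
  (φ : Fin m → Fin n) → (∀ {u} → P u → Q (φ u)) →
  (∀ {u w} → P u → P w → adj G u w ≡ true → φ u ≡ φ w ⊎ adj H (φ u) (φ w) ≡ true) →
  ∀ {u w} → WalkIn G P u w → WalkIn H Q (φ u) (φ w)
walkIn-map φ φ-P φ-adj (stop p) = stop (φ-P p)
walkIn-map φ φ-P φ-adj (step p e w) with φ-adj p (walkIn-head w) e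
... | inj₁ φu≡φw rewrite φu≡φw = walkIn-map φ φ-P φ-adj w
... | inj₂ e′ = step (φ-P p) e′ (walkIn-map φ φ-P φ-adj w)

NoCutVertex : Graph n → Set
NoCutVertex {n} G = ∀ (z x y : Fin n) → x ≢ z → y ≢ z → WalkIn G (_≢ z) x y

noCutVertex-viaHubs : (G : Graph n) →
  (∀ z → ∃ λ h → ∀ x → x ≢ z → WalkIn G (_≢ z) x h) → NoCutVertex G
noCutVertex-viaHubs G hubs z x y x≢z y≢z =
  walkIn-++ (proj₂ (hubs z) x x≢z) (walkIn-reverse (proj₂ (hubs z) y y≢z))

noCutVertex-neighbour : {G : Graph n} → NoCutVertex G → {x y z : Fin n} →
  x ≢ y → x ≢ z → y ≢ z → ∃ λ w → adj G x w ≡ true × w ≢ z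
noCutVertex-neighbour noCut x≢y x≢z y≢z = walkIn-firstStep x≢y (noCut _ _ _ x≢z y≢z)

noCutVertex-resp : {H H′ : Graph n} → H ≈ᴳ H′ → NoCutVertex H → NoCutVertex H′
noCutVertex-resp H≈H′ noCut z x y x≢z y≢z =
  walkIn-map id id (λ _ _ e → inj₂ (trans (sym (H≈H′ _ _)) e)) (noCut z x y x≢z y≢z)

missed-or-surjective : (f : Fin m → Fin n) →
  (∃ λ v → ∀ i → f i ≢ v) ⊎ (∀ v → ∃ λ i → f i ≡ v)
missed-or-surjective f with any? (λ v → all? (λ i → ¬? (f i ≟ v)))
... | yes missed = inj₁ missed
... | no ¬missed = inj₂ hit
  where
  hit : ∀ v → ∃ λ i → f i ≡ v
  hit v with ¬∀⟶∃¬ _ (λ i → f i ≢ v) (λ i → ¬? (f i ≟ v)) (λ all-miss → ¬missed (v , all-miss))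
  ... | i , ¬fi≢v = i , decidable-stable (f i ≟ v) ¬fi≢v

missedVertex : m < n → (f : Fin m → Fin n) → ∃ λ v → ∀ i → f i ≢ v
missedVertex m<n f with missed-or-surjective f
... | inj₁ missed = missed
... | inj₂ surjective = ⊥-elim (<⇒≱ m<n (injective⇒≤ section-injective))
  where
  section-injective : Injective _≡_ _≡_ (λ v → proj₁ (surjective v))
  section-injective {v} {w} eq =
    trans (sym (proj₂ (surjective v))) (trans (cong f eq) (proj₂ (surjective w)))

thirdVertex : 3 ≤ n → (x y : Fin n) → ∃ λ z → z ≢ x × z ≢ y
thirdVertex 3≤n x y with missedVertex 3≤n (λ { zero → x ; (suc _) → y })
... | z , missed = z , ≢-sym (missed zero) , ≢-sym (missed (suc zero))

-- A left inverse of punchIn v that sends v itself to the image of t.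
identify : (v : Fin (suc n)) {t : Fin (suc n)} → v ≢ t → Fin (suc n) → Fin n
identify v v≢t x with v ≟ x
... | yes _ = punchOut v≢t
... | no v≢x = punchOut v≢x

module _ {v t : Fin (suc n)} (v≢t : v ≢ t) where

  punchIn-identify : ∀ {x} → v ≢ x → punchIn v (identify v v≢t x) ≡ x
  punchIn-identify {x} v≢x with v ≟ x
  ... | yes v≡x = ⊥-elim (v≢x v≡x)
  ... | no v≢x′ = punchIn-punchOut v≢x′

  punchIn-identify-self : punchIn v (identify v v≢t v) ≡ t
  punchIn-identify-self with v ≟ v
  ... | yes _ = punchIn-punchOut v≢t
  ... | no v≢v = ⊥-elim (v≢v refl)

  identify-punchIn : ∀ y → identify v v≢t (punchIn v y) ≡ y
  identify-punchIn y =
    punchIn-injective v _ _ (punchIn-identify (≢-sym (punchInᵢ≢i v y)))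

  identify-self : identify v v≢t v ≡ identify v v≢t t
  identify-self = trans (sym (identify-punchIn _)) (cong (identify v v≢t) punchIn-identify-self)

  identify-injective : ∀ {x y} → v ≢ x → v ≢ y → identify v v≢t x ≡ identify v v≢t y → x ≡ y
  identify-injective v≢x v≢y eq =
    trans (sym (punchIn-identify v≢x)) (trans (cong (punchIn v) eq) (punchIn-identify v≢y))

twoConnected⇒noCutVertex : {G : Graph n} → TwoConnected G → NoCutVertex G
twoConnected⇒noCutVertex {suc n} {G} (_ , _ , deletion-connected) z x y x≢z y≢z =
  subst₂ (WalkIn G (_≢ z)) (punchIn-punchOut (≢-sym x≢z)) (punchIn-punchOut (≢-sym y≢z))
    (walkIn-map (punchIn z) (λ {u} _ → punchInᵢ≢i z u)
      (λ _ _ e → inj₂ (trans (sym (deleteV-adj G z _ _)) e))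
      (walk⇒walkIn (deletion-connected z _ _)))

noCutVertex⇒twoConnected : {G : Graph n} → 3 ≤ n → NoCutVertex G → TwoConnected G
noCutVertex⇒twoConnected {suc n} {G} 3≤n noCut = 3≤n , connected , deletion-connected
  where
  connected : Connected G
  connected x y with thirdVertex 3≤n x y
  ... | z , z≢x , z≢y = walkIn⇒walk (noCut z x y (≢-sym z≢x) (≢-sym z≢y))

  deletion-connected : ∀ v → Connected (deleteV G v)
  deletion-connected v x y =
    subst₂ (Walk (deleteV G v)) (identify-punchIn v≢t x) (identify-punchIn v≢t y)
      (walkIn⇒walk (walkIn-map {Q = λ _ → ⊤} (identify v v≢t) (λ _ → tt) edge
        (noCut v (punchIn v x) (punchIn v y) (punchInᵢ≢i v x) (punchInᵢ≢i v y))))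
    where
    v≢t : v ≢ punchIn v x
    v≢t = ≢-sym (punchInᵢ≢i v x)
    ι : Fin (suc n) → Fin n
    ι = identify v v≢t
    edge : ∀ {u w} → u ≢ v → w ≢ v → adj G u w ≡ true → ι u ≡ ι w ⊎ adj (deleteV G v) (ι u) (ι w) ≡ true
    edge {u} {w} u≢v w≢v u~w = inj₂ (begin
      adj (deleteV G v) (ι u) (ι w)                 ≡⟨ deleteV-adj G v (ι u) (ι w) ⟩
      adj G (punchIn v (ι u)) (punchIn v (ι w))     ≡⟨ cong₂ (adj G) (punchIn-identify v≢t (≢-sym u≢v))
                                                                     (punchIn-identify v≢t (≢-sym w≢v)) ⟩
      adj G u w                                     ≡⟨ u~w ⟩
      true                                          ∎)
      where open ≡-Reasoning

twoConnected-resp : {H H′ : Graph n} → H ≈ᴳ H′ → TwoConnected H → TwoConnected H′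
twoConnected-resp {suc n} H≈H′ H-2conn@(3≤n , _) =
  noCutVertex⇒twoConnected 3≤n (noCutVertex-resp H≈H′ (twoConnected⇒noCutVertex H-2conn))

-- Induced copies and minimality

DoublyTwoConnected : Graph n → Set
DoublyTwoConnected H = TwoConnected H × TwoConnected (complement H)

doublyTwoConnected-resp : {H H′ : Graph n} → H ≈ᴳ H′ → DoublyTwoConnected H → DoublyTwoConnected H′
doublyTwoConnected-resp {H = H} {H′} H≈H′ (H-2conn , Hᶜ-2conn) =
  twoConnected-resp H≈H′ H-2conn , twoConnected-resp (complement-cong {H = H} {H′} H≈H′) Hᶜ-2conn

record InducedCopy (H : Graph m) (G : Graph n) : Set where
  field
    embed           : Fin m → Fin n
    embed-injective : Injective _≡_ _≡_ embed
    embed-adj       : ∀ i j → adj G (embed i) (embed j) ≡ adj H i j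
open InducedCopy

inducedCopy-refl : (H : Graph n) → InducedCopy H H
inducedCopy-refl H = record { embed = id ; embed-injective = id ; embed-adj = λ _ _ → refl }

inducedCopy-induced : (G : Graph n) {f : Fin m → Fin n} → Injective _≡_ _≡_ f →
  InducedCopy (induced G f) G
inducedCopy-induced G {f} f-inj = record
  { embed = f ; embed-injective = f-inj ; embed-adj = λ i j → sym (induced-adj G f i j) }

inducedCopy-deleteV : ∀ {m n} {H : Graph m} {G : Graph (suc n)} (copy : InducedCopy H G) →
  (v : Fin (suc n)) → (∀ i → embed copy i ≢ v) → InducedCopy H (deleteV G v)
inducedCopy-deleteV {m} {n} {H = H} {G} copy v missed = record
  { embed = embed′
  ; embed-injective = λ {i} {j} eq → embed-injective copy (punchOut-injective (v≢ i) (v≢ j) eq)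
  ; embed-adj = λ i j → begin
      adj (deleteV G v) (embed′ i) (embed′ j)              ≡⟨ deleteV-adj G v _ _ ⟩
      adj G (punchIn v (embed′ i)) (punchIn v (embed′ j))  ≡⟨ cong₂ (adj G) (punchIn-punchOut (v≢ i))
                                                                            (punchIn-punchOut (v≢ j)) ⟩
      adj G (embed copy i) (embed copy j)                  ≡⟨ embed-adj copy i j ⟩
      adj H i j                                            ∎
  }
  where
  open ≡-Reasoning
  v≢ : ∀ i → v ≢ embed copy i
  v≢ i = ≢-sym (missed i)
  embed′ : Fin m → Fin n
  embed′ i = punchOut (v≢ i)

inducedCopy⇒¬twoCograph : {H : Graph m} {G : Graph n} → InducedCopy H G →
  DoublyTwoConnected H → ¬ TwoCograph G
inducedCopy⇒¬twoCograph {m} {H = H} {G} copy H-2conn G-cograph =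
  G-cograph m (embed copy) (embed-injective copy) (doublyTwoConnected-resp H≈ H-2conn)
  where
  H≈ : H ≈ᴳ induced G (embed copy)
  H≈ i j = sym (trans (induced-adj G (embed copy) i j) (embed-adj copy i j))

noCutVertex-spanningCopy : {H : Graph m} {G : Graph n} (copy : InducedCopy H G) →
  (∀ v → ∃ λ i → embed copy i ≡ v) → NoCutVertex H → NoCutVertex G
noCutVertex-spanningCopy {m} {n} {H} {G} copy onto noCut z x y x≢z y≢z =
  subst₂ (WalkIn G (_≢ z)) (proj₂ (onto x)) (proj₂ (onto y))
    (walkIn-map f avoids-z (λ _ _ e → inj₂ (trans (embed-adj copy _ _) e))
      (noCut (g z) (g x) (g y) (g-≢ x≢z) (g-≢ y≢z)))
  where
  f : Fin m → Fin n
  f = embed copy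
  g : Fin n → Fin m
  g v = proj₁ (onto v)
  avoids-z : ∀ {u} → u ≢ g z → f u ≢ z
  avoids-z u≢gz fu≡z = u≢gz (embed-injective copy (trans fu≡z (sym (proj₂ (onto z)))))
  g-≢ : ∀ {v w} → v ≢ w → g v ≢ g w
  g-≢ {v} {w} v≢w gv≡gw = v≢w (trans (sym (proj₂ (onto v))) (trans (cong f gv≡gw) (proj₂ (onto w))))

module _ {G : Graph (suc n)}
  (minor-cograph : ∀ {m} (H : Graph m) → ProperInducedMinor H G → TwoCograph H) where

  inducedCopy-covers : {H : Graph m} (copy : InducedCopy H G) → DoublyTwoConnected H →
    ∀ v → ¬ (∀ i → embed copy i ≢ v)
  inducedCopy-covers copy H-2conn v missed =
    inducedCopy⇒¬twoCograph (inducedCopy-deleteV copy v missed) H-2conn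
      (minor-cograph (deleteV G v) (del v same))

  smallerInducedCopy-impossible : {H : Graph m} → m < suc n → InducedCopy H G → ¬ DoublyTwoConnected H
  smallerInducedCopy-impossible m<n copy H-2conn with missedVertex m<n (embed copy)
  ... | v , missed = inducedCopy-covers copy H-2conn v missed

  minimal⇒noCutVertex : (f : Fin m → Fin (suc n)) → Injective _≡_ _≡_ f →
    DoublyTwoConnected (induced G f) → NoCutVertex G
  minimal⇒noCutVertex f f-inj H-2conn@(H-twoConnected , _) with missed-or-surjective f
  ... | inj₁ (v , missed) = ⊥-elim (inducedCopy-covers (inducedCopy-induced G f-inj) H-2conn v missed)
  ... | inj₂ onto =
    noCutVertex-spanningCopy (inducedCopy-induced G f-inj) onto (twoConnected⇒noCutVertex H-twoConnected)

NeighboursWithin : Graph n → Fin n → Fin n → Fin n → Set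
NeighboursWithin G v x y = ∀ w → adj G v w ≡ true → w ≡ x ⊎ w ≡ y

neighboursWithin-nonadj : (G : Graph n) (v : Fin n) {x y w : Fin n} → NeighboursWithin G v x y →
  w ≢ x → w ≢ y → adj G v w ≡ false
neighboursWithin-nonadj G v {w = w} nbrs w≢x w≢y = ¬-not v≁w
  where
  v≁w : adj G v w ≢ true
  v≁w v~w with nbrs w v~w
  ... | inj₁ w≡x = w≢x w≡x
  ... | inj₂ w≡y = w≢y w≡y

among-two : ∀ {A : Set} {u u′ x y z : A} → x ∈ u ∷ u′ ∷ [] → y ∈ u ∷ u′ ∷ [] →
  z ∈ u ∷ u′ ∷ [] → x ≢ y → z ≡ x ⊎ z ≡ y
among-two (here refl) (here refl) _ x≢y = ⊥-elim (x≢y refl)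
among-two (there (here refl)) (there (here refl)) _ x≢y = ⊥-elim (x≢y refl)
among-two (here refl) _ (here refl) _ = inj₁ refl
among-two (there (here refl)) _ (there (here refl)) _ = inj₁ refl
among-two _ (here refl) (here refl) _ = inj₂ refl
among-two _ (there (here refl)) (there (here refl)) _ = inj₂ refl

among-length-two : ∀ {A : Set} {xs : List A} {x y z : A} → length xs ≡ 2 →
  x ∈ xs → y ∈ xs → z ∈ xs → x ≢ y → z ≡ x ⊎ z ≡ y
among-length-two {xs = _ ∷ _ ∷ []} refl = among-two

degreeTwo⇒neighboursWithin : (G : Graph n) (v : Fin n) {x y : Fin n} → degree G v ≡ 2 →
  adj G v x ≡ true → adj G v y ≡ true → x ≢ y → NeighboursWithin G v x y
degreeTwo⇒neighboursWithin {n} G v deg v~x v~y x≢y w v~w =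
  among-length-two deg (neighbour v~x) (neighbour v~y) (neighbour v~w) x≢y
  where
  neighbour : ∀ {u} → adj G v u ≡ true → u ∈ filterᵇ (adj G v) (allFin n)
  neighbour v~u = ∈-filter⁺ (T? ∘ adj G v) (∈-allFin _) (Equivalence.from T-≡ v~u)

-- The 5-cycle

walkSearch : (H : Graph n) → ℕ → (i j : Fin n) → Maybe (Walk H i j)
walkSearch H _ i j with i ≟ j
... | yes refl = just nil
walkSearch H zero i j | no _ = nothing
walkSearch {n} H (suc fuel) i j | no _ = firstFound (allFin n)
  where
  firstFound : List (Fin n) → Maybe (Walk H i j)
  firstFound [] = nothing
  firstFound (k ∷ ks) with adj H i k in i~k
  ... | true = maybe′ (λ w → just (cons i~k w)) (firstFound ks) (walkSearch H fuel k j)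
  ... | false = firstFound ks

FoundConnected : Graph n → Set
FoundConnected {n} H = ∀ i j → T (is-just (walkSearch H n i j))

foundConnected? : (H : Graph n) → Dec (FoundConnected H)
foundConnected? H = all? λ i → all? λ j → T? _

twoConnected-bySearch : (H : Graph (suc n)) → 3 ≤ suc n → FoundConnected H →
  (∀ v → FoundConnected (deleteV H v)) → TwoConnected H
twoConnected-bySearch H 3≤n H-found H-v-found =
  3≤n , found⇒connected H-found , λ v → found⇒connected (H-v-found v)
  where
  found⇒connected : ∀ {k} {K : Graph k} → FoundConnected K → Connected K
  found⇒connected found i j = to-witness-T _ (found i j)

next : Fin 5 → Fin 5
next zero = suc zero
next (suc zero) = suc (suc zero)
next (suc (suc zero)) = suc (suc (suc zero))
next (suc (suc (suc zero))) = suc (suc (suc (suc zero)))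
next (suc (suc (suc (suc zero)))) = zero

C5 : Graph 5
C5 = fromRel (λ i j → j == next i)

C5-edge : ∀ i → adj C5 i (next i) ≡ true
C5-edge = from-yes (all? λ i → adj C5 i (next i) Bool.≟ true)

C5-chord : ∀ i → adj C5 i (next (next i)) ≡ false
C5-chord = from-yes (all? λ i → adj C5 i (next (next i)) Bool.≟ false)

Ahead : Fin 5 → Fin 5 → Set
Ahead i j = j ≡ next i ⊎ j ≡ next (next i)

ahead? : ∀ i j → Dec (Ahead i j)
ahead? i j = (j ≟ next i) ⊎-dec (j ≟ next (next i))

C5-pairs : ∀ i j → i ≡ j ⊎ Ahead i j ⊎ Ahead j i
C5-pairs = from-yes (all? λ i → all? λ j → (i ≟ j) ⊎-dec ahead? i j ⊎-dec ahead? j i)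

C5-doublyTwoConnected : DoublyTwoConnected C5
C5-doublyTwoConnected =
  twoConnected-bySearch C5 3≤5 (from-yes (foundConnected? C5))
    (from-yes (all? λ v → foundConnected? (deleteV C5 v))) ,
  twoConnected-bySearch (complement C5) 3≤5 (from-yes (foundConnected? (complement C5)))
    (from-yes (all? λ v → foundConnected? (deleteV (complement C5) v)))
  where
  3≤5 : 3 ≤ 5
  3≤5 = s≤s (s≤s (s≤s z≤n))

TwinFree : Graph n → Set
TwinFree {n} H = ∀ (i j : Fin n) → i ≡ j ⊎ ∃ λ k → adj H i k ≢ adj H j k

twinFree⇒injective : {H : Graph m} {G : Graph n} {f : Fin m → Fin n} → TwinFree H →
  (∀ i j → adj G (f i) (f j) ≡ adj H i j) → Injective _≡_ _≡_ f
twinFree⇒injective {H = H} {G} {f} twinFree f-adj {i} {j} fi≡fj with twinFree i j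
... | inj₁ i≡j = i≡j
... | inj₂ (k , distinguished) = ⊥-elim (distinguished (begin
  adj H i k          ≡⟨ sym (f-adj i k) ⟩
  adj G (f i) (f k)  ≡⟨ cong (λ x → adj G x (f k)) fi≡fj ⟩
  adj G (f j) (f k)  ≡⟨ f-adj j k ⟩
  adj H j k          ∎))
  where open ≡-Reasoning

C5-twinFree : TwinFree C5
C5-twinFree = from-yes (all? λ i → all? λ j →
  (i ≟ j) ⊎-dec any? λ k → ¬? (adj C5 i k Bool.≟ adj C5 j k))

chordlessPentagon⇒inducedCopy : {G : Graph n} (v : Fin 5 → Fin n) →
  (∀ i → adj G (v i) (v (next i)) ≡ true) →
  (∀ i → adj G (v i) (v (next (next i))) ≡ false) → InducedCopy C5 G
chordlessPentagon⇒inducedCopy {G = G} v edge chord = record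
  { embed = v
  ; embed-injective = twinFree⇒injective {H = C5} {G = G} C5-twinFree same-adj
  ; embed-adj = same-adj
  }
  where
  ahead-adj : ∀ i j → Ahead i j → adj G (v i) (v j) ≡ adj C5 i j
  ahead-adj i _ (inj₁ refl) = trans (edge i) (sym (C5-edge i))
  ahead-adj i _ (inj₂ refl) = trans (chord i) (sym (C5-chord i))
  same-adj : ∀ i j → adj G (v i) (v j) ≡ adj C5 i j
  same-adj i j with C5-pairs i j
  ... | inj₁ refl = trans (irrefl G (v i)) (sym (irrefl C5 i))
  ... | inj₂ (inj₁ j-ahead) = ahead-adj i j j-ahead
  ... | inj₂ (inj₂ i-ahead) = trans (symm G (v i) (v j)) (trans (ahead-adj j i i-ahead) (symm C5 j i))

pentagon-inducedCopy : ∀ {n} (G : Graph n) {a b c d s : Fin n} → a ≢ b → a ≢ d →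
  NeighboursWithin G b a c → NeighboursWithin G c b d →
  adj G a b ≡ true → adj G b c ≡ true → adj G c d ≡ true → adj G d s ≡ true → adj G s a ≡ true →
  adj G a d ≡ false → InducedCopy C5 G
pentagon-inducedCopy {n} G {a} {b} {c} {d} {s} a≢b a≢d b-nbrs c-nbrs a~b b~c c~d d~s s~a a≁d =
  chordlessPentagon⇒inducedCopy v edge chord
  where
  v : Fin 5 → Fin n
  v = lookup (a ∷ b ∷ c ∷ d ∷ s ∷ [])
  b≁d : adj G b d ≡ false
  b≁d = neighboursWithin-nonadj G b b-nbrs (≢-sym a≢d) (≢-sym (adj⇒≢ G c~d))
  a≁c : adj G a c ≡ false
  a≁c = trans (symm G a c) (neighboursWithin-nonadj G c c-nbrs a≢b a≢d)
  edge : ∀ i → adj G (v i) (v (next i)) ≡ true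
  edge zero = a~b
  edge (suc zero) = b~c
  edge (suc (suc zero)) = c~d
  edge (suc (suc (suc zero))) = d~s
  edge (suc (suc (suc (suc zero)))) = s~a
  chord : ∀ i → adj G (v i) (v (next (next i))) ≡ false
  chord zero = a≁c
  chord (suc zero) = b≁d
  chord (suc (suc zero)) = neighboursWithin-nonadj G c c-nbrs
    (distinct-by-adj G d~s (trans (symm G d b) b≁d)) (≢-sym (adj⇒≢ G d~s))
  chord (suc (suc (suc zero))) = trans (symm G d a) a≁d
  chord (suc (suc (suc (suc zero)))) = trans (symm G s b) (neighboursWithin-nonadj G b b-nbrs
    (adj⇒≢ G s~a) (distinct-by-adj G (adj-flip G s~a) a≁c))

-- Contracting an edge

module _ (G : Graph (suc n)) (u v : Fin (suc n)) where

  private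
    Gc : Graph n
    Gc = contract G u v
    contract-rel : Fin n → Fin n → Bool
    contract-rel x y = adj G (punchIn v x) (punchIn v y) ∨ ((punchIn v x == u) ∧ adj G v (punchIn v y))

  contract-adj-preserved : ∀ {x y p q} → punchIn v x ≡ p → punchIn v y ≡ q →
    adj G p q ≡ true → adj Gc x y ≡ true
  contract-adj-preserved {x} {y} refl refl p~q =
    fromRel-adj-intro contract-rel (λ x≡y → adj⇒≢ G p~q (cong (punchIn v) x≡y))
      (cong (_∨ ((punchIn v x == u) ∧ adj G v (punchIn v y))) p~q)

  contract-adj-away : ∀ {x y p q} → punchIn v x ≡ p → punchIn v y ≡ q → p ≢ u → q ≢ u →
    adj Gc x y ≡ adj G p q
  contract-adj-away {x} {y} refl refl p≢u q≢u = by-cases (x ≟ y)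
    where
    open ≡-Reasoning
    p q : Fin (suc n)
    p = punchIn v x
    q = punchIn v y
    by-cases : Dec (x ≡ y) → adj Gc x y ≡ adj G p q
    by-cases (yes refl) = trans (irrefl Gc x) (sym (irrefl G p))
    by-cases (no x≢y) = begin
      adj Gc x y
        ≡⟨ fromRel-adj contract-rel x≢y ⟩
      (adj G p q ∨ ((p == u) ∧ adj G v q)) ∨ (adj G q p ∨ ((q == u) ∧ adj G v p))
        ≡⟨ cong₂ (λ s t → (adj G p q ∨ (s ∧ adj G v q)) ∨ (adj G q p ∨ (t ∧ adj G v p)))
                 (==-≢ p≢u) (==-≢ q≢u) ⟩
      (adj G p q ∨ false) ∨ (adj G q p ∨ false)
        ≡⟨ cong₂ _∨_ (∨-identityʳ _) (trans (∨-identityʳ _) (symm G q p)) ⟩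
      adj G p q ∨ adj G p q
        ≡⟨ ∨-idem _ ⟩
      adj G p q ∎

  contract-adj-merged : ∀ {x y q} → punchIn v x ≡ u → punchIn v y ≡ q → q ≢ u →
    adj Gc x y ≡ adj G u q ∨ adj G v q
  contract-adj-merged {x} {y} px≡u refl q≢u = begin
    adj Gc x y
      ≡⟨ fromRel-adj contract-rel x≢y ⟩
    (adj G p q ∨ ((p == u) ∧ adj G v q)) ∨ (adj G q p ∨ ((q == u) ∧ adj G v p))
      ≡⟨ cong₂ (λ s t → (adj G p q ∨ (s ∧ adj G v q)) ∨ (adj G q p ∨ (t ∧ adj G v p)))
               (==-≡ px≡u) (==-≢ q≢u) ⟩
    (adj G p q ∨ adj G v q) ∨ (adj G q p ∨ false)
      ≡⟨ cong ((adj G p q ∨ adj G v q) ∨_) (trans (∨-identityʳ _) (symm G q p)) ⟩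
    (adj G p q ∨ adj G v q) ∨ adj G p q
      ≡⟨ ∨-reabsorb (adj G p q) (adj G v q) ⟩
    adj G p q ∨ adj G v q
      ≡⟨ cong (λ s → adj G s q ∨ adj G v q) px≡u ⟩
    adj G u q ∨ adj G v q ∎
    where
    open ≡-Reasoning
    p q : Fin (suc n)
    p = punchIn v x
    q = punchIn v y
    x≢y : x ≢ y
    x≢y x≡y = q≢u (trans (cong (punchIn v) (sym x≡y)) px≡u)
    ∨-reabsorb : ∀ a b → (a ∨ b) ∨ a ≡ a ∨ b
    ∨-reabsorb true _ = refl
    ∨-reabsorb false b = ∨-identityʳ b

Outside : Fin n → Fin n → Fin n → Fin n → Set
Outside A B D x = x ≢ A × x ≢ B × x ≢ D

-- Applied below to the complement of G/bc: B is the merged vertex and S, T are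
-- neighbours in G of d and a.
module HubRouting (H : Graph n) {A B D S T : Fin n}
  (A≢B : A ≢ B) (B≢D : B ≢ D) (S≢T : S ≢ T)
  (S-outside : Outside A B D S) (T-outside : Outside A B D T)
  (A~D : adj H A D ≡ true) (A~S : adj H A S ≡ true) (D~T : adj H D T ≡ true)
  (B~outside : ∀ x → Outside A B D x → adj H B x ≡ true)
  (outside~A-or-D : ∀ x → Outside A B D x → adj H x A ≡ true ⊎ adj H x D ≡ true)
  where

  private
    classify : ∀ x → x ≡ A ⊎ x ≡ B ⊎ x ≡ D ⊎ Outside A B D x
    classify x with x ≟ A | x ≟ B | x ≟ D
    ... | yes x≡A | _ | _ = inj₁ x≡A
    ... | no _ | yes x≡B | _ = inj₂ (inj₁ x≡B)
    ... | no _ | no _ | yes x≡D = inj₂ (inj₂ (inj₁ x≡D))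
    ... | no x≢A | no x≢B | no x≢D = inj₂ (inj₂ (inj₂ (x≢A , x≢B , x≢D)))

    toward-B : ∀ {z x} → x ≢ z → B ≢ z → Outside A B D x → WalkIn H (_≢ z) x B
    toward-B x≢z B≢z x-out = step x≢z (adj-flip H (B~outside _ x-out)) (stop B≢z)

    avoiding-A : ∀ x → x ≢ A → WalkIn H (_≢ A) x B
    avoiding-A x x≢A with classify x
    ... | inj₁ x≡A = ⊥-elim (x≢A x≡A)
    ... | inj₂ (inj₁ refl) = stop x≢A
    ... | inj₂ (inj₂ (inj₁ refl)) = step x≢A D~T (toward-B (proj₁ T-outside) (≢-sym A≢B) T-outside)
    ... | inj₂ (inj₂ (inj₂ x-out)) = toward-B x≢A (≢-sym A≢B) x-out

    avoiding-B : ∀ x → x ≢ B → WalkIn H (_≢ B) x D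
    avoiding-B x x≢B with classify x
    ... | inj₁ refl = step x≢B A~D (stop (≢-sym B≢D))
    ... | inj₂ (inj₁ x≡B) = ⊥-elim (x≢B x≡B)
    ... | inj₂ (inj₂ (inj₁ refl)) = stop x≢B
    ... | inj₂ (inj₂ (inj₂ x-out)) with outside~A-or-D x x-out
    ...   | inj₁ x~A = step x≢B x~A (step A≢B A~D (stop (≢-sym B≢D)))
    ...   | inj₂ x~D = step x≢B x~D (stop (≢-sym B≢D))

    avoiding-D : ∀ x → x ≢ D → WalkIn H (_≢ D) x B
    avoiding-D x x≢D with classify x
    ... | inj₁ refl = step x≢D A~S (toward-B (proj₂ (proj₂ S-outside)) B≢D S-outside)
    ... | inj₂ (inj₁ refl) = stop x≢D
    ... | inj₂ (inj₂ (inj₁ x≡D)) = ⊥-elim (x≢D x≡D)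
    ... | inj₂ (inj₂ (inj₂ x-out)) = toward-B x≢D B≢D x-out

    avoiding-outside : ∀ z → Outside A B D z → ∀ x → x ≢ z → WalkIn H (_≢ z) x B
    avoiding-outside z (z≢A , z≢B , z≢D) x x≢z with classify x
    ... | inj₂ (inj₁ refl) = stop x≢z
    ... | inj₂ (inj₂ (inj₂ x-out)) = toward-B x≢z (≢-sym z≢B) x-out
    ... | inj₁ refl with S ≟ z
    ...   | no S≢z = step x≢z A~S (toward-B S≢z (≢-sym z≢B) S-outside)
    ...   | yes refl = step x≢z A~D (step (≢-sym z≢D) D~T
                         (toward-B (≢-sym S≢T) (≢-sym z≢B) T-outside))
    avoiding-outside z (z≢A , z≢B , z≢D) x x≢z | inj₂ (inj₂ (inj₁ refl)) with T ≟ z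
    ...   | no T≢z = step x≢z D~T (toward-B T≢z (≢-sym z≢B) T-outside)
    ...   | yes refl = step x≢z (adj-flip H A~D) (step (≢-sym z≢A) A~S
                         (toward-B S≢T (≢-sym z≢B) S-outside))

  noCutVertex : NoCutVertex H
  noCutVertex = noCutVertex-viaHubs H hub
    where
    hub : ∀ z → ∃ λ h → ∀ x → x ≢ z → WalkIn H (_≢ z) x h
    hub z with classify z
    ... | inj₁ refl = B , avoiding-A
    ... | inj₂ (inj₁ refl) = D , avoiding-B
    ... | inj₂ (inj₂ (inj₁ refl)) = B , avoiding-D
    ... | inj₂ (inj₂ (inj₂ z-out)) = B , avoiding-outside z z-out

module ContractionCase (G : Graph (suc n)) (3≤n : 3 ≤ n) {a b c d : Fin (suc n)}
  (a≢b : a ≢ b) (a≢c : a ≢ c) (a≢d : a ≢ d) (b≢c : b ≢ c) (b≢d : b ≢ d) (c≢d : c ≢ d)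
  (c~d : adj G c d ≡ true) (a≁d : adj G a d ≡ false)
  (b-nbrs : NeighboursWithin G b a c) (c-nbrs : NeighboursWithin G c b d)
  (no-common : ∀ w → adj G a w ≡ true → adj G d w ≡ true → ⊥)
  (noCut : NoCutVertex G)
  where

  Gc : Graph n
  Gc = contract G b c

  K : Graph n
  K = complement Gc

  private
    pc : Fin n → Fin (suc n)
    pc = punchIn c

    d≢b : d ≢ b
    d≢b = ≢-sym b≢d

    d≢c : d ≢ c
    d≢c = ≢-sym c≢d

  merged-adj-d : ∀ {X Y} → pc X ≡ b → pc Y ≡ d → adj Gc X Y ≡ true
  merged-adj-d pX pY =
    trans (contract-adj-merged G b c pX pY d≢b) (trans (cong (adj G b d ∨_) c~d) (∨-zeroʳ _))

  adj-b-d : ∀ {X Y p q} → pc X ≡ p → pc Y ≡ q → p ≢ q → p ≡ b ⊎ p ≡ d → q ≡ b ⊎ q ≡ d →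
    adj Gc X Y ≡ true
  adj-b-d pX pY _ (inj₁ refl) (inj₂ refl) = merged-adj-d pX pY
  adj-b-d pX pY _ (inj₂ refl) (inj₁ refl) = adj-flip Gc (merged-adj-d pY pX)
  adj-b-d _ _ p≢q (inj₁ refl) (inj₁ refl) = ⊥-elim (p≢q refl)
  adj-b-d _ _ p≢q (inj₂ refl) (inj₂ refl) = ⊥-elim (p≢q refl)

  -- A walk of G is pushed into Gc by sending c to whichever t ∈ {b, d} is not
  -- deleted; an edge at c then either collapses or becomes the Gc-edge bd.
  collapse-c-edge : ∀ {t} (c≢t : c ≢ t) → t ≡ b ⊎ t ≡ d → ∀ {w} → c ≢ w → adj G c w ≡ true →
    identify c c≢t c ≡ identify c c≢t w ⊎ adj Gc (identify c c≢t c) (identify c c≢t w) ≡ true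
  collapse-c-edge {t} c≢t t∈bd {w} c≢w c~w with t ≟ w
  ... | yes refl = inj₁ (identify-self c≢t)
  ... | no t≢w = inj₂ (adj-b-d (punchIn-identify-self c≢t) (punchIn-identify c≢t c≢w) t≢w
                                t∈bd (c-nbrs w c~w))

  collapse-edge : ∀ {t} (c≢t : c ≢ t) → t ≡ b ⊎ t ≡ d → ∀ {u w} → adj G u w ≡ true →
    identify c c≢t u ≡ identify c c≢t w ⊎ adj Gc (identify c c≢t u) (identify c c≢t w) ≡ true
  collapse-edge c≢t t∈bd u~w = by-cases (c ≟ _) (c ≟ _) u~w
    where
    by-cases : ∀ {u w} → Dec (c ≡ u) → Dec (c ≡ w) → adj G u w ≡ true →
      identify c c≢t u ≡ identify c c≢t w ⊎ adj Gc (identify c c≢t u) (identify c c≢t w) ≡ true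
    by-cases (yes refl) (yes refl) u~w = ⊥-elim (adj⇒≢ G u~w refl)
    by-cases (yes refl) (no c≢w) u~w = collapse-c-edge c≢t t∈bd c≢w u~w
    by-cases (no c≢u) (yes refl) u~w =
      ⊎-map sym (adj-flip Gc) (collapse-c-edge c≢t t∈bd c≢u (adj-flip G u~w))
    by-cases (no c≢u) (no c≢w) u~w =
      inj₂ (contract-adj-preserved G b c (punchIn-identify c≢t c≢u) (punchIn-identify c≢t c≢w) u~w)

  walk-avoiding : ∀ {t} (c≢t : c ≢ t) → t ≡ b ⊎ t ≡ d → ∀ {z} → t ≢ pc z →
    ∀ x y → x ≢ z → y ≢ z → WalkIn Gc (_≢ z) x y
  walk-avoiding {t} c≢t t∈bd {z} t≢pz x y x≢z y≢z =
    subst₂ (WalkIn Gc (_≢ z)) (identify-punchIn c≢t x) (identify-punchIn c≢t y)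
      (walkIn-map (identify c c≢t) avoids (λ _ _ → collapse-edge c≢t t∈bd)
        (noCut (pc z) (pc x) (pc y) (x≢z ∘ punchIn-injective c x z) (y≢z ∘ punchIn-injective c y z)))
    where
    avoids : ∀ {u} → u ≢ pc z → identify c c≢t u ≢ z
    avoids u≢pz = by-cases (c ≟ _) u≢pz
      where
      by-cases : ∀ {u} → Dec (c ≡ u) → u ≢ pc z → identify c c≢t u ≢ z
      by-cases (yes refl) _ ψc≡z = t≢pz (trans (sym (punchIn-identify-self c≢t)) (cong pc ψc≡z))
      by-cases (no c≢u) u≢pz ψu≡z = u≢pz (trans (sym (punchIn-identify c≢t c≢u)) (cong pc ψu≡z))

  Gc-noCutVertex : NoCutVertex Gc
  Gc-noCutVertex z with pc z ≟ b
  ... | yes pz≡b = walk-avoiding c≢d (inj₂ refl) (λ d≡pz → b≢d (trans (sym pz≡b) (sym d≡pz)))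
  ... | no pz≢b = walk-avoiding (≢-sym b≢c) (inj₁ refl) (≢-sym pz≢b)

  private
    ι : Fin (suc n) → Fin n
    ι = identify c (≢-sym b≢c)

    pc-ι : ∀ {u} → u ≢ c → pc (ι u) ≡ u
    pc-ι u≢c = punchIn-identify (≢-sym b≢c) (≢-sym u≢c)

    ι-pc : ∀ x → ι (pc x) ≡ x
    ι-pc = identify-punchIn (≢-sym b≢c)

    ι-≢ : ∀ {u w} → u ≢ c → w ≢ c → u ≢ w → ι u ≢ ι w
    ι-≢ u≢c w≢c u≢w = u≢w ∘ identify-injective (≢-sym b≢c) (≢-sym u≢c) (≢-sym w≢c)

    pc-≢ : ∀ {x u} → x ≢ ι u → pc x ≢ u
    pc-≢ {x} x≢ιu pcx≡u = x≢ιu (trans (sym (ι-pc x)) (cong ι pcx≡u))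

    ι-outside : ∀ {u} → u ≢ a → u ≢ b → u ≢ c → u ≢ d → Outside (ι a) (ι b) (ι d) (ι u)
    ι-outside u≢a u≢b u≢c u≢d = ι-≢ u≢c a≢c u≢a , ι-≢ u≢c b≢c u≢b , ι-≢ u≢c d≢c u≢d

    outside-pc : ∀ {x} → Outside (ι a) (ι b) (ι d) x → pc x ≢ a × pc x ≢ b × pc x ≢ c × pc x ≢ d
    outside-pc {x} (x≢A , x≢B , x≢D) = pc-≢ x≢A , pc-≢ x≢B , punchInᵢ≢i c x , pc-≢ x≢D

    K-adj-away : ∀ {u w} → u ≢ b → u ≢ c → w ≢ b → w ≢ c → u ≢ w → adj G u w ≡ false →
      adj K (ι u) (ι w) ≡ true
    K-adj-away u≢b u≢c w≢b w≢c u≢w u≁w = complement-adj Gc (ι-≢ u≢c w≢c u≢w)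
      (trans (contract-adj-away G b c (pc-ι u≢c) (pc-ι w≢c) u≢b w≢b) u≁w)

    K-adj-b : ∀ {w} → w ≢ b → w ≢ c → adj G b w ≡ false → adj G c w ≡ false →
      adj K (ι b) (ι w) ≡ true
    K-adj-b w≢b w≢c b≁w c≁w = complement-adj Gc (ι-≢ b≢c w≢c (≢-sym w≢b))
      (trans (contract-adj-merged G b c (pc-ι b≢c) (pc-ι w≢c) w≢b) (cong₂ _∨_ b≁w c≁w))

    a≁c : adj G a c ≡ false
    a≁c = trans (symm G a c) (neighboursWithin-nonadj G c c-nbrs a≢b a≢d)

    d≁b : adj G d b ≡ false
    d≁b = trans (symm G d b) (neighboursWithin-nonadj G b b-nbrs (≢-sym a≢d) d≢c)

    not-common : ∀ {w} → adj G a w ≡ true → adj G d w ≡ false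
    not-common a~w = ¬-not (no-common _ a~w)

    t-choice : ∃ λ t → adj G a t ≡ true × t ≢ b
    t-choice = noCutVertex-neighbour noCut a≢d a≢b (≢-sym b≢d)

    s-choice : ∃ λ s → adj G d s ≡ true × s ≢ c
    s-choice = noCutVertex-neighbour noCut (≢-sym a≢d) d≢c a≢c

    t s : Fin (suc n)
    t = proj₁ t-choice
    s = proj₁ s-choice

    a~t : adj G a t ≡ true
    a~t = proj₁ (proj₂ t-choice)

    d~s : adj G d s ≡ true
    d~s = proj₁ (proj₂ s-choice)

    t≢a : t ≢ a
    t≢a = ≢-sym (adj⇒≢ G a~t)

    t≢b : t ≢ b
    t≢b = proj₂ (proj₂ t-choice)

    t≢c : t ≢ c
    t≢c = distinct-by-adj G a~t a≁c

    t≢d : t ≢ d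
    t≢d = distinct-by-adj G a~t a≁d

    s≢a : s ≢ a
    s≢a = distinct-by-adj G d~s (trans (symm G d a) a≁d)

    s≢b : s ≢ b
    s≢b = distinct-by-adj G d~s d≁b

    s≢c : s ≢ c
    s≢c = proj₂ (proj₂ s-choice)

    s≢d : s ≢ d
    s≢d = ≢-sym (adj⇒≢ G d~s)

    s≢t : s ≢ t
    s≢t = distinct-by-adj G d~s (not-common a~t)

    b~outside : ∀ x → Outside (ι a) (ι b) (ι d) x → adj K (ι b) x ≡ true
    b~outside x x-out with outside-pc x-out
    ... | u≢a , u≢b , u≢c , u≢d = subst (λ y → adj K (ι b) y ≡ true) (ι-pc x)
      (K-adj-b u≢b u≢c (neighboursWithin-nonadj G b b-nbrs u≢a u≢c)
                       (neighboursWithin-nonadj G c c-nbrs u≢b u≢d))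

    outside~a-or-d : ∀ x → Outside (ι a) (ι b) (ι d) x →
      adj K x (ι a) ≡ true ⊎ adj K x (ι d) ≡ true
    outside~a-or-d x x-out with outside-pc x-out | adj G a (pc x) in a-u
    ... | u≢a , u≢b , u≢c , u≢d | false = inj₁ (subst (λ y → adj K y (ι a) ≡ true) (ι-pc x)
      (K-adj-away u≢b u≢c a≢b a≢c u≢a (trans (symm G _ a) a-u)))
    ... | u≢a , u≢b , u≢c , u≢d | true = inj₂ (subst (λ y → adj K y (ι d) ≡ true) (ι-pc x)
      (K-adj-away u≢b u≢c d≢b d≢c u≢d (trans (symm G _ d) (not-common a-u))))

  K-noCutVertex : NoCutVertex K
  K-noCutVertex = HubRouting.noCutVertex K
    (ι-≢ a≢c b≢c a≢b) (ι-≢ b≢c d≢c b≢d) (ι-≢ s≢c t≢c s≢t)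
    (ι-outside s≢a s≢b s≢c s≢d) (ι-outside t≢a t≢b t≢c t≢d)
    (K-adj-away a≢b a≢c d≢b d≢c a≢d a≁d)
    (K-adj-away a≢b a≢c s≢b s≢c (≢-sym s≢a) (¬-not (λ a~s → no-common s a~s d~s)))
    (K-adj-away d≢b d≢c t≢b t≢c (≢-sym t≢d) (not-common a~t))
    b~outside outside~a-or-d

  doublyTwoConnected : DoublyTwoConnected Gc
  doublyTwoConnected =
    noCutVertex⇒twoConnected 3≤n Gc-noCutVertex , noCutVertex⇒twoConnected 3≤n K-noCutVertex

lemma3p8 : ∀ {n} (G : Graph n) → MinimalNon2Cograph G → 6 ≤ n →
    (a b c d : Fin n) →
    a ≢ b → a ≢ c → a ≢ d → b ≢ c → b ≢ d → c ≢ d →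
    adj G a b ≡ true → adj G b c ≡ true → adj G c d ≡ true →
    degree G b ≡ 2 → degree G c ≡ 2 →
    adj G a d ≡ true
lemma3p8 {suc n} G (non-cograph , minor-cograph) 6≤n a b c d a≢b a≢c a≢d b≢c b≢d c≢d
  a~b b~c c~d deg-b deg-c = decidable-stable (adj G a d Bool.≟ true) (nonadjacent-impossible ∘ ¬-not)
  where
  b-nbrs : NeighboursWithin G b a c
  b-nbrs = degreeTwo⇒neighboursWithin G b deg-b (adj-flip G a~b) b~c a≢c
  c-nbrs : NeighboursWithin G c b d
  c-nbrs = degreeTwo⇒neighboursWithin G c deg-c (adj-flip G b~c) c~d b≢d
  3≤n : 3 ≤ n
  3≤n = ≤-trans (s≤s (s≤s (s≤s z≤n))) (≤-pred 6≤n)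

  nonadjacent-impossible : adj G a d ≡ false → ⊥
  nonadjacent-impossible a≁d with any? (λ s → (adj G a s Bool.≟ true) ×-dec (adj G d s Bool.≟ true))
  ... | yes (s , a~s , d~s) = smallerInducedCopy-impossible minor-cograph 6≤n
    (pentagon-inducedCopy G a≢b a≢d b-nbrs c-nbrs a~b b~c c~d d~s (adj-flip G a~s) a≁d)
    C5-doublyTwoConnected
  ... | no no-common = non-cograph λ _ f f-inj f-bad →
    inducedCopy⇒¬twoCograph (inducedCopy-refl (contract G b c))
      (ContractionCase.doublyTwoConnected G 3≤n a≢b a≢c a≢d b≢c b≢d c≢d c~d a≁d b-nbrs c-nbrs
        (λ w a~w d~w → no-common (w , a~w , d~w)) (minimal⇒noCutVertex minor-cograph f f-inj f-bad))
      (minor-cograph (contract G b c) (con b c b~c same))
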